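{- Let $S$ be a set of positive integers and $P$ a set of primes such that every element of $S$ is less than every element of $P$. Let $s, s'$ be any two monomials in the variables $q_j$, $j\in S$, and let $p, p'$ be distinct monomials in the variables $q_j$, $j \in P$. Then $h(sp) \ne h(s'p')$.
   Context: $h$ is the multiplicative map (ring homomorphism) from monomials in variables $q_j$ ($j$ a positive integer) to monomials in variables $q$ and $x_p$ ($p$ prime) defined by $h(q_j) = q^j \prod_{p \text{ prime}} x_p^{\sum_{l\ge1}\lfloor j/p^l\rfloor}$, i.e. $h(q_j)$ records $j$ in the exponent of $q$ and the prime factorization of $j!$ in the $x$-variables. -}

module Defs where

open import Data.Nat using (ℕ; zero; suc; _+_; _*_; _^_; _/_)
open import Data.Nat.Properties using (m^n≢0)
open import Data.Nat.Primality using (Prime)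
open import Data.List using (List; []; _∷_; map; applyUpTo)
open import Data.Nat.ListAction using (sum)
open import Data.Product using (_×_)
open import Relation.Binary.PropositionalEquality using (_≡_)

-- A monomial in the variables q_j (j ∈ ℕ) is a finite multiset of indices,
-- represented as a list of indices (with multiplicity); two lists denote the
-- same monomial iff they are permutations of each other (Data.List ... _↭_).
-- The product of monomials is list concatenation _++_.
QMonomial : Set
QMonomial = List ℕ

-- Legendre's formula: exponent of the prime r in j!, i.e. Σ_{l≥1} ⌊j / r^l⌋.
-- For r ≥ 2 the terms with l > j vanish, so summing l = 1..j is the full sum.
-- (r = 0 is never prime; it is assigned 0.)
legendre : ℕ → ℕ → ℕ
legendre zero    j = 0
legendre (suc r) j =
  sum (applyUpTo (λ i → _/_ j (suc r ^ suc i) {{m^n≢0 (suc r) (suc i)}}) j)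

-- The image h(m) is a monomial in q and x_r (r prime):
--   exponent of q   in h(m) = Σ_{j ∈ m} j
--   exponent of x_r in h(m) = Σ_{j ∈ m} legendre r j
qExp : QMonomial → ℕ
qExp m = sum m

xExp : ℕ → QMonomial → ℕ
xExp r m = sum (map (legendre r) m)

hEq : QMonomial → QMonomial → Set
hEq m m' = (qExp m ≡ qExp m') × (∀ r → Prime r → xExp r m ≡ xExp r m')

-- For a prime r of P, every index in s or s′ is smaller than r and so contributes nothing
-- to the exponent of x_r, since r ∤ j! for j < r. Hence the exponents of x_r, r ∈ P, in
-- h(p) and h(p′) agree. These exponents determine a monomial in the variables q_r, r ∈ P:
-- the largest index m occurring in p or p′ occurs in both, because the prime m divides m! but no
-- j! with j < m; cancelling q_m and recursing gives p = p′.
module Submission where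

open import Defs
open import Data.Nat using (ℕ; zero; suc; _+_; _^_; _<_; _≤_; NonZero)
open import Data.Nat.Properties
  using (_≟_; ≤-trans; ≤-reflexive; <-≤-trans; ≤∧≢⇒<; m≤m+n; m≤n+m; m≤m*n; m^n≢0
        ; *-identityʳ; suc-injective; +-cancelˡ-≡; <⇒≱)
open import Data.Nat.DivMod using (m<n⇒m/n≡0; m≥n⇒m/n>0)
open import Data.Nat.Primality using (Prime; prime⇒nonZero)
open import Data.Nat.ListAction using (sum)
open import Data.Nat.ListAction.Properties using (sum-++; sum-↭)
open import Data.List using ([]; _∷_; _++_; map; applyUpTo; length)
open import Data.List.Properties using (map-++)
open import Data.List.Extrema.Nat using (max; xs≤max; argmax-sel)
open import Data.List.Relation.Unary.All using (All; []; _∷_; lookup; zipWith)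
import Data.List.Relation.Unary.All as All
open import Data.List.Relation.Unary.All.Properties using (¬Any⇒All¬; ++⁺; ++⁻ˡ; ++⁻ʳ)
open import Data.List.Relation.Unary.Any using (here; there)
open import Data.List.Membership.Propositional using (_∈_)
open import Data.List.Membership.Propositional.Properties using (∈-∃++; ∈-++⁻)
open import Data.List.Membership.DecPropositional _≟_ using (_∈?_)
open import Data.List.Relation.Binary.Permutation.Propositional
  using (_↭_; ↭-refl; ↭-sym; ↭-trans; prep)
open import Data.List.Relation.Binary.Permutation.Propositional.Properties
  using (shift; map⁺; ↭-length; All-resp-↭)
open import Data.Product using (_×_; _,_; ∃-syntax)
open import Data.Sum using (_⊎_; inj₁; inj₂)
open import Function using (id)
open import Relation.Nullary using (¬_; yes; no; contradiction)
open import Relation.Binary.PropositionalEquality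
  using (_≡_; refl; sym; trans; cong; subst; module ≡-Reasoning)

sum-applyUpTo-≡0 : ∀ (f : ℕ → ℕ) n → (∀ i → f i ≡ 0) → sum (applyUpTo f n) ≡ 0
sum-applyUpTo-≡0 f zero    f≡0 = refl
sum-applyUpTo-≡0 f (suc n) f≡0 rewrite f≡0 0 =
  sum-applyUpTo-≡0 (λ i → f (suc i)) n (λ i → f≡0 (suc i))

∈⇒↭∷ : ∀ {m : ℕ} {l} → m ∈ l → ∃[ rest ] l ↭ m ∷ rest
∈⇒↭∷ {m} m∈l with xs , ys , refl ← ∈-∃++ m∈l = xs ++ ys , shift m xs ys

legendre-< : ∀ {r j} → j < r → legendre r j ≡ 0
legendre-< {zero}  _   = refl
legendre-< {suc r} {j} j<r = sum-applyUpTo-≡0 _ j λ i →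
  m<n⇒m/n≡0 {{m^n≢0 (suc r) (suc i)}}
    (<-≤-trans j<r (m≤m*n (suc r) (suc r ^ i) {{m^n≢0 (suc r) i}}))

legendre-self-pos : ∀ r .{{_ : NonZero r}} → 0 < legendre r r
legendre-self-pos (suc r) =
  ≤-trans (m≥n⇒m/n>0 {{m^n≢0 (suc r) 1}} (≤-reflexive (*-identityʳ (suc r)))) (m≤m+n _ _)

xExp-++ : ∀ r l l′ → xExp r (l ++ l′) ≡ xExp r l + xExp r l′
xExp-++ r l l′ = trans (cong sum (map-++ (legendre r) l l′)) (sum-++ (map (legendre r) l) _)

xExp-↭ : ∀ r {l l′} → l ↭ l′ → xExp r l ≡ xExp r l′
xExp-↭ r l↭l′ = sum-↭ (map⁺ (legendre r) l↭l′)

xExp-< : ∀ {r l} → All (_< r) l → xExp r l ≡ 0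
xExp-< []            = refl
xExp-< (j<r ∷ l<r) rewrite legendre-< j<r = xExp-< l<r

xExp-<-++ : ∀ {r l} l′ → All (_< r) l → xExp r (l ++ l′) ≡ xExp r l′
xExp-<-++ {r} {l} l′ l<r = trans (xExp-++ r l l′) (cong (_+ xExp r l′) (xExp-< l<r))

legendre≤xExp : ∀ r {m l} → m ∈ l → legendre r m ≤ xExp r l
legendre≤xExp r (here refl) = m≤m+n _ _
legendre≤xExp r (there m∈l) = ≤-trans (legendre≤xExp r m∈l) (m≤n+m _ _)

max∈xExp : ∀ {m l l′} .{{_ : NonZero m}} → m ∈ l → All (_≤ m) l′ →
           xExp m l ≡ xExp m l′ → m ∈ l′
max∈xExp {m} {l} {l′} m∈l l′≤m eq with m ∈? l′
... | yes m∈l′ = m∈l′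
... | no  m∉l′ = contradiction (begin
      legendre m m  ≤⟨ legendre≤xExp m m∈l ⟩
      xExp m l      ≡⟨ eq ⟩
      xExp m l′     ≡⟨ xExp-< l′<m ⟩
      0             ∎) (<⇒≱ (legendre-self-pos m))
  where
  open Data.Nat.Properties.≤-Reasoning
  l′<m : All (_< m) l′
  l′<m = zipWith (λ (j≤m , m≢j) → ≤∧≢⇒< j≤m (λ j≡m → m≢j (sym j≡m))) (l′≤m , ¬Any⇒All¬ l′ m∉l′)

module _ {P : ℕ → Set} (P⇒NonZero : ∀ {r} → P r → NonZero r) where

  SameXExp : QMonomial → QMonomial → Set
  SameXExp l l′ = ∀ r → P r → xExp r l ≡ xExp r l′

  common-element : ∀ {x l l′} → All P l → All P l′ → SameXExp l l′ →
                   x ∈ l ++ l′ → ∃[ m ] m ∈ l × m ∈ l′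
  common-element {x} {l} {l′} Pl Pl′ same x∈ll′ = m , in-both (∈-++⁻ l m∈ll′)
    where
    m : ℕ
    m = max x (l ++ l′)
    m∈ll′ : m ∈ l ++ l′
    m∈ll′ with argmax-sel id x (l ++ l′)
    ... | inj₁ m≡x  = subst (_∈ l ++ l′) (sym m≡x) x∈ll′
    ... | inj₂ m∈ll′ = m∈ll′
    ll′≤m : All (_≤ m) (l ++ l′)
    ll′≤m = xs≤max x (l ++ l′)
    Pm : P m
    Pm = lookup (++⁺ Pl Pl′) m∈ll′
    instance
      m≢0 : NonZero m
      m≢0 = P⇒NonZero Pm
    in-both : m ∈ l ⊎ m ∈ l′ → m ∈ l × m ∈ l′
    in-both (inj₁ m∈l)  = m∈l , max∈xExp m∈l (++⁻ʳ l ll′≤m) (same m Pm)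
    in-both (inj₂ m∈l′) = max∈xExp m∈l′ (++⁻ˡ l ll′≤m) (sym (same m Pm)) , m∈l′

  SameXExp-cancel : ∀ {m l l′ q q′} → l ↭ m ∷ q → l′ ↭ m ∷ q′ →
                    SameXExp l l′ → SameXExp q q′
  SameXExp-cancel {m} l↭ l′↭ same r Pr = +-cancelˡ-≡ (legendre r m) _ _
    (trans (sym (xExp-↭ r l↭)) (trans (same r Pr) (xExp-↭ r l′↭)))

  SameXExp⇒↭ : ∀ {l l′} → All P l → All P l′ → SameXExp l l′ → l ↭ l′
  SameXExp⇒↭ = go _ refl
    where
    go : ∀ n {l l′} → length l ≡ n → All P l → All P l′ → SameXExp l l′ → l ↭ l′
    go _ {[]} {[]} _ _ _ _ = ↭-refl
    go _ {[]} {_ ∷ _} _ Pl Pl′ same with common-element Pl Pl′ same (here refl)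
    ... | _ , () , _
    go (suc n) {_ ∷ _} len Pl Pl′ same with common-element Pl Pl′ same (here refl)
    ... | m , m∈l , m∈l′ with q , l↭ ← ∈⇒↭∷ m∈l | q′ , l′↭ ← ∈⇒↭∷ m∈l′ =
      ↭-trans l↭ (↭-trans (prep m (go n |q|≡n Pq Pq′ (SameXExp-cancel l↭ l′↭ same))) (↭-sym l′↭))
      where
      |q|≡n = suc-injective (trans (sym (↭-length l↭)) len)
      Pq  = All.tail (All-resp-↭ l↭ Pl)
      Pq′ = All.tail (All-resp-↭ l′↭ Pl′)

lemma9 : (S P : ℕ → Set)
    → (∀ j → S j → 0 < j)
    → (∀ r → P r → Prime r)
    → (∀ a b → S a → P b → a < b)
    → (s s' p p' : QMonomial)
    → All S s → All S s' → All P p → All P p'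
    → ¬ (p ↭ p')
    → ¬ hEq (s ++ p) (s' ++ p')
-- Neither the positivity of the indices in S nor the exponent of q is needed.
lemma9 S P _ P⇒Prime S<P s s' p p' Ss Ss' Pp Pp' p≁p' (_ , sameX) =
  p≁p' (SameXExp⇒↭ (λ Pr → prime⇒nonZero (P⇒Prime _ Pr)) Pp Pp' same)
  where
  same : ∀ r → P r → xExp r p ≡ xExp r p'
  same r Pr = begin
    xExp r p           ≡⟨ sym (xExp-<-++ p (below Ss)) ⟩
    xExp r (s ++ p)    ≡⟨ sameX r (P⇒Prime r Pr) ⟩
    xExp r (s' ++ p')  ≡⟨ xExp-<-++ p' (below Ss') ⟩
    xExp r p'          ∎
    where
    open ≡-Reasoning
    below : ∀ {l} → All S l → All (_< r) l
    below = All.map (λ Sj → S<P _ r Sj Pr)
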